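{- For any directed graph $G=(V,E)$ on $n$ nodes, any set of sources $S \subseteq V$, and any set of pairs $P \subseteq S \times V$, there is a subgraph $H$ of $G$ with $O\left(n+\sqrt{n \cdot |P| \cdot |S|}\right)$ edges that preserves the reachability of all pairs in $P$; that is, for every $(s,t) \in P$, there is a directed path from $s$ to $t$ in $H$ if and only if there is one in $G$.
   Context: Graphs are directed. The $O(\cdot)$ hides an absolute constant independent of $G$, $S$, $P$ and $n$. -}

module Defs where

open import Data.Nat using (ℕ)
open import Data.Fin using (Fin)
open import Data.Product using (_×_; _,_)
open import Data.List using (List)
open import Data.List.Membership.Propositional using (_∈_)
open import Data.List.Relation.Unary.Unique.Propositional using (Unique)
open import Relation.Binary.Construct.Closure.ReflexiveTransitive using (Star)

-- A directed graph on the vertex set Fin n, given by its list of edges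
-- (each edge (u , v) is an arc u → v); edges are required to be distinct,
-- so the edge count is the length of the list.
record Digraph (n : ℕ) : Set where
  constructor digraph
  field
    edges    : List (Fin n × Fin n)
    distinct : Unique edges
open Digraph public

Edge : ∀ {n} → Digraph n → Fin n → Fin n → Set
Edge G u v = (u , v) ∈ edges G

Reachable : ∀ {n} → Digraph n → Fin n → Fin n → Set
Reachable G = Star (Edge G)

_⊆G_ : ∀ {n} → Digraph n → Digraph n → Set
H ⊆G G = ∀ {e} → e ∈ edges H → e ∈ edges G

-- Prune G greedily: drop an edge whenever all pairs of P stay connected without it.  In the
-- result H every edge e is critical for some pair π e ∈ P: H connects π e, H minus e does not.
-- An edge on a cycle of H lies in the out- or in-forest spanning its strongly connected
-- component from a fixed representative, since otherwise the two forests route around it;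
-- so at most 2n edges lie on cycles.  Call two distinct acyclic edges with the same head
-- siblings.  For sibling pairs (e , f) the value (π e , source of π f) ∈ P × S determines the
-- pair, so there are at most |P|·|S| of them.  Hence for any d, at most |P|·|S|/d acyclic
-- edges have d or more siblings and at most n·d have fewer; d ≈ √(n|P||S|)/n balances the two.
module Submission where

open import Defs
open import Data.Empty using (⊥-elim)
open import Data.Fin using (Fin; zero; suc; _≟_)
open import Data.Fin.Properties using (all?; ¬∀⟶∃¬)
open import Data.Fin.Subset using (Subset; _∈_; ∣_∣; inside; outside)
open import Data.List using (List; []; _∷_; _++_; length; map; filter; concatMap; cartesianProduct; allFin)
open import Data.List.Membership.Propositional using (_∉_; find) renaming (_∈_ to _∈ₗ_)
open import Data.List.Membership.Propositional.Properties
  using ( ∈-∃++; ∈-++⁻; ∈-++⁺ˡ; ∈-++⁺ʳ; ∈-filter⁻; ∈-filter⁺; ∈-map⁻; ∈-map⁺; ∈-concatMap⁻; ∈-allFin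
        ; ∈-cartesianProduct⁺)
open import Data.List.Properties using (length-++; length-map; length-++-sucʳ; length-tabulate)
open import Data.List.Relation.Binary.Disjoint.Propositional using (Disjoint)
open import Data.List.Relation.Binary.Subset.Propositional using (_⊆_)
open import Data.List.Relation.Binary.Subset.Propositional.Properties using (filter⁺′)
open import Data.List.Relation.Unary.All using (All)
import Data.List.Relation.Unary.All as All
open import Data.List.Relation.Unary.All.Properties using (¬All⇒Any¬)
open import Data.List.Relation.Unary.AllPairs using ([]; _∷_)
open import Data.List.Relation.Unary.Any using (here; there)
open import Data.List.Relation.Unary.Unique.Propositional using (Unique)
import Data.List.Relation.Unary.Unique.Propositional.Properties as Unique
open import Data.Nat using (ℕ; zero; suc; _+_; _*_; _≤_; _<_; _≤?_; z≤n; s≤s; NonZero)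
open import Data.Nat.DivMod using (_/_; _%_; m≡m%n+[m/n]*n; m%n<n; m/n*n≤m)
open import Data.Nat.Properties
  using ( ≤-trans; ≤-<-trans; +-suc; +-comm; +-identityʳ; *-suc; *-comm; *-assoc; +-mono-≤; +-monoʳ-≤
        ; +-monoˡ-<; *-monoˡ-≤; *-monoʳ-≤; *-mono-<; *-cancelˡ-<; ≰⇒>; 1+n≰n; n<1+n; m≤m+n
        ; m≤n⇒m≤1+n; m<1+n⇒m≤n; module ≤-Reasoning)
open import Data.Nat.Solver using (module +-*-Solver)
open import Data.Product using (_×_; _,_; proj₁; proj₂; ∃-syntax; map₁; swap; uncurry)
open import Data.Product.Properties using (≡-dec)
open import Data.Sum using (_⊎_; inj₁; inj₂)
open import Data.Vec using ([]; _∷_; here; there)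
open import Function using (id; _∘_; case_of_)
open import Function.Bundles using (_⇔_; mk⇔)
open import Relation.Binary.Construct.Closure.ReflexiveTransitive using (Star; ε; _◅_; _◅◅_)
import Relation.Binary.Construct.Closure.ReflexiveTransitive as Star
open import Relation.Binary.Definitions using (DecidableEquality)
open import Relation.Binary.PropositionalEquality
  using (_≡_; _≢_; refl; sym; trans; cong; cong₂; subst; module ≡-Reasoning)
open import Relation.Nullary using (¬_; Dec; yes; no; ¬?)
import Relation.Nullary.Decidable as Dec
open import Relation.Nullary.Decidable using (_×-dec_; _⊎-dec_; _→-dec_)
open import Relation.Unary using (Decidable)
open import Relation.Unary.Properties using (∁?)

module _ {A B : Set} where

  length-≤-injection : (f : A → B) {xs : List A} {ys : List B} → Unique xs →
                       (∀ {x} → x ∈ₗ xs → f x ∈ₗ ys) →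
                       (∀ {x y} → x ∈ₗ xs → y ∈ₗ xs → f x ≡ f y → x ≡ y) →
                       length xs ≤ length ys
  length-≤-injection f {[]} _ _ _ = z≤n
  length-≤-injection f {x ∷ xs} (x∉xs ∷ uxs) into inj
    with us , ws , refl ← ∈-∃++ (into (here refl)) =
    subst (suc (length xs) ≤_) (sym (length-++-sucʳ us (f x) ws))
      (s≤s (length-≤-injection f uxs into′ (λ p q → inj (there p) (there q))))
    where
    into′ : ∀ {y} → y ∈ₗ xs → f y ∈ₗ us ++ ws
    into′ {y} y∈xs with ∈-++⁻ us (into (there y∈xs))
    ... | inj₁ fy∈us = ∈-++⁺ˡ fy∈us
    ... | inj₂ (there fy∈ws) = ∈-++⁺ʳ us fy∈ws
    ... | inj₂ (here fy≡fx) = ⊥-elim (All.lookup x∉xs y∈xs (sym (inj (there y∈xs) (here refl) fy≡fx)))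

  length-cartesianProduct : (xs : List A) (ys : List B) →
                            length (cartesianProduct xs ys) ≡ length xs * length ys
  length-cartesianProduct []       ys = refl
  length-cartesianProduct (x ∷ xs) ys = begin
    length (map (x ,_) ys ++ cartesianProduct xs ys)
      ≡⟨ length-++ (map (x ,_) ys) ⟩
    length (map (x ,_) ys) + length (cartesianProduct xs ys)
      ≡⟨ cong₂ _+_ (length-map (x ,_) ys) (length-cartesianProduct xs ys) ⟩
    length ys + length xs * length ys
      ∎
    where open ≡-Reasoning

module _ {A : Set} where

  length-≤-⊆ : {xs ys : List A} → Unique xs → xs ⊆ ys → length xs ≤ length ys
  length-≤-⊆ uxs xs⊆ys = length-≤-injection id uxs xs⊆ys (λ _ _ → id)

  length-filter-∁ : {P : A → Set} (P? : Decidable P) (xs : List A) →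
                    length (filter P? xs) + length (filter (∁? P?) xs) ≡ length xs
  length-filter-∁ P? [] = refl
  length-filter-∁ P? (x ∷ xs) with P? x
  ... | yes _ = cong suc (length-filter-∁ P? xs)
  ... | no  _ = trans (+-suc _ _) (cong suc (length-filter-∁ P? xs))

module _ {A B : Set} (_≟_ : DecidableEquality B) (g : A → B) where

  fibre : B → List A → List A
  fibre b = filter (λ x → g x ≟ b)

  length-≤-fibres : ∀ {d} {xs ys : List A} (vs : List B) → Unique xs → xs ⊆ ys →
                    (∀ {x} → x ∈ₗ xs → g x ∈ₗ vs) →
                    (∀ {x} → x ∈ₗ xs → length (fibre (g x) ys) ≤ d) →
                    length xs ≤ length vs * d
  length-≤-fibres {xs = []}    []       _ _ _    _ = z≤n
  length-≤-fibres {xs = _ ∷ _} []       _ _ into _ with () ← into (here refl)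
  length-≤-fibres {d} {xs} {ys} (v ∷ vs) uxs xs⊆ys into small =
    subst (_≤ d + length vs * d) (length-filter-∁ (λ x → g x ≟ v) xs)
      (+-mono-≤ (fibre-bound (fibre v xs) (Unique.filter⁺ _ uxs) id)
                (length-≤-fibres vs (Unique.filter⁺ _ uxs) (xs⊆ys ∘ proj₁ ∘ ∈-filter⁻ _) into-vs
                   (small ∘ proj₁ ∘ ∈-filter⁻ _)))
    where
    into-vs : ∀ {x} → x ∈ₗ filter (∁? (λ x → g x ≟ v)) xs → g x ∈ₗ vs
    into-vs x∈ with x∈xs , gx≢v ← ∈-filter⁻ (∁? (λ x → g x ≟ v)) x∈ with into x∈xs
    ... | here gx≡v  = ⊥-elim (gx≢v gx≡v)
    ... | there gx∈vs = gx∈vs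
    fibre-bound : ∀ zs → Unique zs → zs ⊆ fibre v xs → length zs ≤ d
    fibre-bound []       _   _      = z≤n
    fibre-bound (z ∷ zs) uzs zs⊆fib with z∈xs , gz≡v ← ∈-filter⁻ _ (zs⊆fib (here refl)) =
      ≤-trans (length-≤-⊆ uzs (λ w∈ → let w∈xs , gw≡v = ∈-filter⁻ _ (zs⊆fib w∈)
                                      in ∈-filter⁺ _ (xs⊆ys w∈xs) (trans gw≡v (sym gz≡v))))
              (small z∈xs)

module _ {A B : Set} (block : A → List B) where

  pairs : List A → List (A × B)
  pairs = concatMap (λ a → map (a ,_) (block a))

  ∈-pairs⁻ : ∀ {xs p} → p ∈ₗ pairs xs → proj₁ p ∈ₗ xs × proj₂ p ∈ₗ block (proj₁ p)
  ∈-pairs⁻ {xs} p∈ with a , a∈xs , p∈a ← find (∈-concatMap⁻ (λ a → map (a ,_) (block a)) {xs} p∈)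
                   with b , b∈ , refl ← ∈-map⁻ (a ,_) p∈a = a∈xs , b∈

  pairs-unique : ∀ {xs} → Unique xs → (∀ a → Unique (block a)) → Unique (pairs xs)
  pairs-unique {[]}     _             _  = []
  pairs-unique {a ∷ xs} (a∉xs ∷ uxs) ub =
    Unique.++⁺ (Unique.map⁺ (cong proj₂) (ub a)) (pairs-unique uxs ub) disjoint
    where
    disjoint : Disjoint (map (a ,_) (block a)) (pairs xs)
    disjoint (p∈a , p∈xs) with _ , _ , refl ← ∈-map⁻ (a ,_) p∈a =
      All.lookup a∉xs (proj₁ (∈-pairs⁻ p∈xs)) refl

  length-pairs-≥ : ∀ {d} xs → (∀ {a} → a ∈ₗ xs → d ≤ length (block a)) →
                   length xs * d ≤ length (pairs xs)
  length-pairs-≥     []       _     = z≤n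
  length-pairs-≥ {d} (a ∷ xs) large = begin
    d + length xs * d                              ≤⟨ +-mono-≤ (large (here refl)) (length-pairs-≥ xs (large ∘ there)) ⟩
    length (block a) + length (pairs xs)           ≡⟨ cong (_+ length (pairs xs)) (length-map (a ,_) (block a)) ⟨
    length (map (a ,_) (block a)) + length (pairs xs) ≡⟨ length-++ (map (a ,_) (block a)) ⟨
    length (pairs (a ∷ xs))                        ∎
    where open ≤-Reasoning

elements : ∀ {n} → Subset n → List (Fin n)
elements []            = []
elements (inside  ∷ p) = zero ∷ map suc (elements p)
elements (outside ∷ p) = map suc (elements p)

length-elements : ∀ {n} (p : Subset n) → length (elements p) ≡ ∣ p ∣
length-elements []            = refl
length-elements (inside  ∷ p) = cong suc (trans (length-map suc (elements p)) (length-elements p))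
length-elements (outside ∷ p) = trans (length-map suc (elements p)) (length-elements p)

∈-elements : ∀ {n} {p : Subset n} {x} → x ∈ p → x ∈ₗ elements p
∈-elements {p = inside  ∷ p} here        = here refl
∈-elements {p = inside  ∷ p} (there x∈p) = there (∈-map⁺ suc (∈-elements x∈p))
∈-elements {p = outside ∷ p} (there x∈p) = ∈-map⁺ suc (∈-elements x∈p)

module _ {A : Set} {Q : A → Set} (Q? : Decidable Q) where

  first : A → List A → A
  first d []       = d
  first d (x ∷ xs) with Q? x
  ... | yes _ = x
  ... | no  _ = first d xs

  first-sound : ∀ d {xs x} → x ∈ₗ xs → Q x → first d xs ∈ₗ xs × Q (first d xs)
  first-sound d {y ∷ xs} x∈ qx with Q? y
  first-sound d {y ∷ xs} x∈          qx | yes qy = here refl , qy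
  first-sound d {y ∷ xs} (here refl) qx | no ¬qy = ⊥-elim (¬qy qx)
  first-sound d {y ∷ xs} (there x∈)  qx | no _   = map₁ there (first-sound d x∈ qx)

first-cong : ∀ {A : Set} {Q R : A → Set} (Q? : Decidable Q) (R? : Decidable R) →
             (∀ {x} → Q x → R x) → (∀ {x} → R x → Q x) →
             ∀ d e {xs x} → x ∈ₗ xs → Q x → first Q? d xs ≡ first R? e xs
first-cong Q? R? Q⇒R R⇒Q d e {y ∷ xs} x∈ qx with Q? y | R? y
... | yes _  | yes _  = refl
... | yes qy | no ¬ry = ⊥-elim (¬ry (Q⇒R qy))
... | no ¬qy | yes ry = ⊥-elim (¬qy (R⇒Q ry))
first-cong Q? R? Q⇒R R⇒Q d e (here refl) qx | no ¬qy | no _ = ⊥-elim (¬qy qx)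
first-cong Q? R? Q⇒R R⇒Q d e (there x∈)  qx | no _   | no _ = first-cong Q? R? Q⇒R R⇒Q d e x∈ qx

module _ {V : Set} (R : V → V → Set) where

  Avoiding : V × V → V → V → Set
  Avoiding e x y = R x y × (x , y) ≢ e

  NotEntering : V → V → V → Set
  NotEntering v x y = R x y × y ≢ v

crossing : ∀ {V : Set} {R : V → V → Set} {Q : V → Set} → Decidable Q → ∀ {a b} → Star R a b →
           Q a → ¬ Q b → ∃[ x ] ∃[ y ] (Q x × ¬ Q y × R x y × Star R a x × Star R y b)
crossing Q? ε qa ¬qb = ⊥-elim (¬qb qa)
crossing Q? {a} (_◅_ {j = y} r p) qa ¬qb with Q? y
... | no  ¬qy = a , y , qa , ¬qy , r , ε , p
... | yes qy  with x , z , qx , ¬qz , r′ , q , q′ ← crossing Q? p qy ¬qb =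
  x , z , qx , ¬qz , r′ , r ◅ q , q′

module Avoidance {V : Set} (_≟_ : DecidableEquality V) (R : V → V → Set) where

  private
    _≟ₑ_ : DecidableEquality (V × V)
    _≟ₑ_ = ≡-dec _≟_ _≟_

  forget-avoiding : ∀ {e x y} → Star (Avoiding R e) x y → Star R x y
  forget-avoiding = Star.map proj₁

  not-entering⇒avoiding : ∀ {e x y} → Star (NotEntering R (proj₂ e)) x y → Star (Avoiding R e) x y
  not-entering⇒avoiding = Star.map λ (r , y≢v) → r , y≢v ∘ cong proj₂

  avoid-or-suffix : ∀ e {x t} → Star R x t → Star (Avoiding R e) x t ⊎ Star (Avoiding R e) (proj₂ e) t
  avoid-or-suffix e ε = inj₁ ε
  avoid-or-suffix e {x} (_◅_ {j = y} r p) with avoid-or-suffix e p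
  ... | inj₂ q = inj₂ q
  ... | inj₁ q with (x , y) ≟ₑ e
  ...   | yes refl = inj₂ q
  ...   | no  x≢e  = inj₁ ((r , x≢e) ◅ q)

  avoid-or-prefix : ∀ e {x t} → Star R x t →
                    Star (Avoiding R e) x t ⊎ (Star (Avoiding R e) x (proj₁ e) × Star R (proj₂ e) t)
  avoid-or-prefix e ε = inj₁ ε
  avoid-or-prefix e {x} (_◅_ {j = y} r p) with (x , y) ≟ₑ e
  ... | yes refl = inj₂ (ε , p)
  ... | no  x≢e  with avoid-or-prefix e p
  ...   | inj₁ q        = inj₁ ((r , x≢e) ◅ q)
  ...   | inj₂ (q , q′) = inj₂ ((r , x≢e) ◅ q , q′)

  first-arrival : ∀ {s v} → Star R s v → s ≡ v ⊎ ∃[ u ] (Star (NotEntering R v) s u × R u v)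
  first-arrival ε = inj₁ refl
  first-arrival {s} {v} (_◅_ {j = y} r p) with y ≟ v
  ... | yes refl = inj₂ (s , ε , r)
  ... | no  y≢v  with first-arrival p
  ...   | inj₁ y≡v          = ⊥-elim (y≢v y≡v)
  ...   | inj₂ (u , q , r′) = inj₂ (u , (r , y≢v) ◅ q , r′)

  bypass : ∀ {e} → Star (Avoiding R e) (proj₁ e) (proj₂ e) → ∀ {x y} → Star R x y → Star (Avoiding R e) x y
  bypass detour ε = ε
  bypass {e} detour (_◅_ {i = x} {j = y} r p) with (x , y) ≟ₑ e
  ... | yes refl = detour ◅◅ bypass detour p
  ... | no  x≢e  = (r , x≢e) ◅ bypass detour p

module _ {V : Set} where

  EdgeIn : List (V × V) → V → V → Set
  EdgeIn L x y = (x , y) ∈ₗ L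

  Reach : List (V × V) → V → V → Set
  Reach L = Star (EdgeIn L)

  reach-∷⁻ : ∀ {a b L x y} → Reach ((a , b) ∷ L) x y → Reach L x y ⊎ (Reach L x a × Reach L b y)
  reach-∷⁻ ε = inj₁ ε
  reach-∷⁻ (here refl ◅ p) with reach-∷⁻ p
  ... | inj₁ q       = inj₂ (ε , q)
  ... | inj₂ (_ , q) = inj₂ (ε , q)
  reach-∷⁻ (there r ◅ p) with reach-∷⁻ p
  ... | inj₁ q        = inj₁ (r ◅ q)
  ... | inj₂ (q , q′) = inj₂ (r ◅ q , q′)

  reach-∷⁺ : ∀ {a b L x y} → Reach L x y ⊎ (Reach L x a × Reach L b y) → Reach ((a , b) ∷ L) x y
  reach-∷⁺ (inj₁ p)       = Star.map there p
  reach-∷⁺ (inj₂ (p , q)) = Star.map there p ◅◅ here refl ◅ Star.map there q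

  reach? : DecidableEquality V → ∀ L x y → Dec (Reach L x y)
  reach? _≟_ []            x y = Dec.map′ (λ { refl → ε }) (λ { ε → refl ; (() ◅ _) }) (x ≟ y)
  reach? _≟_ ((a , b) ∷ L) x y =
    Dec.map′ reach-∷⁺ reach-∷⁻ (reach? _≟_ L x y ⊎-dec (reach? _≟_ L x a ×-dec reach? _≟_ L b y))

  reach-swap : ∀ {L x y} → Reach L x y → Reach (map swap L) y x
  reach-swap = Star.reverse (∈-map⁺ swap)

  reach-unswap : ∀ {L x y} → Reach (map swap L) x y → Reach L y x
  reach-unswap = Star.reverse λ xy∈ → case ∈-map⁻ swap xy∈ of λ { (_ , yx∈ , refl) → yx∈ }

module MinimalSublist {A : Set} (_≟_ : DecidableEquality A) {Good : List A → Set}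
                      (good? : Decidable Good) (good-mono : ∀ {xs ys} → xs ⊆ ys → Good xs → Good ys) where

  remove : A → List A → List A
  remove a = filter (λ x → ¬? (x ≟ a))

  ∈-remove⁻ : ∀ {a x} xs → x ∈ₗ remove a xs → x ∈ₗ xs × x ≢ a
  ∈-remove⁻ {a} xs = ∈-filter⁻ (λ x → ¬? (x ≟ a)) {xs = xs}

  ∈-remove⁺ : ∀ {a x xs} → x ∈ₗ xs → x ≢ a → x ∈ₗ remove a xs
  ∈-remove⁺ {a} = ∈-filter⁺ (λ x → ¬? (x ≟ a))

  record Pruned (xs ys : List A) : Set where
    field
      kept     : List A
      kept⊆    : kept ⊆ xs
      unique   : Unique kept
      good     : Good kept
      needed   : ∀ {y} → y ∈ₗ ys → y ∈ₗ kept → ¬ Good (remove y kept)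

  prune : ∀ xs → Unique xs → Good xs → ∀ ys → Pruned xs ys
  prune xs uxs gxs []       = record { kept = xs ; kept⊆ = id ; unique = uxs ; good = gxs ; needed = λ () }
  prune xs uxs gxs (y ∷ ys) with good? (remove y xs)
  ... | yes g = record { Pruned rest ; kept⊆ = proj₁ ∘ ∈-remove⁻ xs ∘ kept⊆ ; needed = needed′ }
    where
    rest = prune (remove y xs) (Unique.filter⁺ _ uxs) g ys
    open Pruned rest
    needed′ : ∀ {z} → z ∈ₗ y ∷ ys → z ∈ₗ kept → ¬ Good (remove z kept)
    needed′ (here refl) y∈ = ⊥-elim (proj₂ (∈-remove⁻ xs (kept⊆ y∈)) refl)
    needed′ (there z∈)  = needed z∈
  ... | no ¬g = record { Pruned rest ; needed = needed′ }
    where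
    rest = prune xs uxs gxs ys
    open Pruned rest
    needed′ : ∀ {z} → z ∈ₗ y ∷ ys → z ∈ₗ kept → ¬ Good (remove z kept)
    needed′ (here refl) _ = ¬g ∘ good-mono (filter⁺′ _ _ id kept⊆)
    needed′ (there z∈)  = needed z∈

∉⇒Unique-∷ : ∀ {A : Set} {x : A} {xs} → x ∉ xs → Unique xs → Unique (x ∷ xs)
∉⇒Unique-∷ x∉xs uxs = All.tabulate (λ { y∈xs refl → x∉xs y∈xs }) ∷ uxs

_≟ₑ_ : ∀ {n} → DecidableEquality (Fin n × Fin n)
_≟ₑ_ = ≡-dec _≟_ _≟_

Unique⇒length≤ : ∀ {n} {R : List (Fin n)} → Unique R → length R ≤ n
Unique⇒length≤ {n} {R} uR = subst (length R ≤_) (length-tabulate id) (length-≤-⊆ uR (λ {x} _ → ∈-allFin x))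

module SpanningForest {n : ℕ} (L : List (Fin n × Fin n)) (ρ : Fin n → Fin n)
                      (ρ-reaches : ∀ v → Reach L (ρ v) v)
                      (ρ-stable : ∀ {x v} → Reach L (ρ v) x → Reach L x v → ρ x ≡ ρ v) where

  open import Data.List.Membership.DecPropositional (_≟_ {n}) using (_∈?_)

  record Forest (R : List (Fin n)) : Set where
    field
      arcs   : List (Fin n × Fin n)
      arcs⊆L : arcs ⊆ L
      unique : Unique R
      size   : length arcs ≤ length R
      spans  : ∀ {x} → x ∈ₗ R → Reach arcs (ρ x) x

  extend : ∀ {R v} → Forest R → v ∉ R → ∃[ y ] (y ∉ R × Forest (y ∷ R))
  extend {R} {v} F v∉R with ρ v ∈? R
  ... | no ρv∉R = ρ v , ρv∉R , record
    { Forest F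
    ; unique = ∉⇒Unique-∷ ρv∉R unique
    ; size   = m≤n⇒m≤1+n size
    ; spans  = λ { (here refl) → subst (λ z → Reach arcs z (ρ v)) (sym (ρ-stable ε (ρ-reaches v))) ε
                 ; (there x∈R) → spans x∈R }
    }
    where open Forest F
  ... | yes ρv∈R with x , y , x∈R , y∉R , xy∈L , ρv⇝x , y⇝v ← crossing (_∈? R) (ρ-reaches v) ρv∈R v∉R =
    y , y∉R , record
    { arcs   = (x , y) ∷ arcs
    ; arcs⊆L = λ { (here refl) → xy∈L ; (there e∈) → arcs⊆L e∈ }
    ; unique = ∉⇒Unique-∷ y∉R unique
    ; size   = s≤s size
    ; spans  = λ { (here refl) → subst (λ z → Reach ((x , y) ∷ arcs) z y) ρx≡ρy
                                   (Star.map there (spans x∈R) ◅◅ here refl ◅ ε)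
                 ; (there z∈R) → Star.map there (spans z∈R) }
    }
    where
    open Forest F
    ρx≡ρy : ρ x ≡ ρ y
    ρx≡ρy = trans (ρ-stable ρv⇝x (xy∈L ◅ y⇝v)) (sym (ρ-stable (ρv⇝x ◅◅ xy∈L ◅ ε) y⇝v))

  saturate : ∀ k {R} → length R + k ≡ n → Forest R → ∃[ R′ ] (Forest R′ × ∀ v → v ∈ₗ R′)
  saturate k {R} |R|+k≡n F with all? (_∈? R)
  ... | yes all∈R = R , F , all∈R
  ... | no ¬all∈R with v , v∉R ← ¬∀⟶∃¬ n _ (_∈? R) ¬all∈R with k
  ...   | suc k = let _ , _ , F′ = extend F v∉R in saturate k (trans (sym (+-suc _ k)) |R|+k≡n) F′
  ...   | zero  = ⊥-elim (1+n≰n (subst (λ m → suc m ≤ n) (trans (sym (+-identityʳ _)) |R|+k≡n)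
                                   (Unique⇒length≤ (∉⇒Unique-∷ v∉R (Forest.unique F)))))

  empty : Forest []
  empty = record { arcs = [] ; arcs⊆L = λ () ; unique = [] ; size = z≤n ; spans = λ () }

  spanning-forest : ∃[ F ] (F ⊆ L × length F ≤ n × ∀ v → Reach F (ρ v) v)
  spanning-forest with _ , F , all∈ ← saturate n refl empty =
    arcs , arcs⊆L , ≤-trans size (Unique⇒length≤ unique) , λ v → spans (all∈ v)
    where open Forest F

map-swap-⊆ : ∀ {A B : Set} {xs : List (B × A)} {ys : List (A × B)} → xs ⊆ map swap ys → map swap xs ⊆ ys
map-swap-⊆ xs⊆ x∈ with _ , y∈ , refl ← ∈-map⁻ swap x∈ with _ , z∈ , refl ← ∈-map⁻ swap (xs⊆ y∈) = z∈

module CriticalEdges {n : ℕ} (H : List (Fin n × Fin n)) (π : Fin n × Fin n → Fin n × Fin n)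
                     (π-reach : ∀ {e} → e ∈ₗ H → uncurry (Reach H) (π e))
                     (π-cut : ∀ {e} → e ∈ₗ H → ¬ uncurry (Star (Avoiding (EdgeIn H) e)) (π e)) where

  open Avoidance (_≟_ {n}) (EdgeIn H)
  open import Data.List.Membership.DecPropositional (_≟ₑ_ {n}) using (_∈?_)

  source target : Fin n × Fin n → Fin n
  source = proj₁ ∘ π
  target = proj₂ ∘ π

  Avoids : Fin n × Fin n → Fin n → Fin n → Set
  Avoids e = Star (Avoiding (EdgeIn H) e)

  cut : ∀ {e x} → e ∈ₗ H → x ≡ source e → ¬ Avoids e x (target e)
  cut e∈H refl = π-cut e∈H

  source⇝tail : ∀ {e} → e ∈ₗ H → Avoids e (source e) (proj₁ e)
  source⇝tail {e} e∈H with avoid-or-prefix e (π-reach e∈H)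
  ... | inj₁ s⇝t     = ⊥-elim (π-cut e∈H s⇝t)
  ... | inj₂ (p , _) = p

  head⇝target : ∀ {e} → e ∈ₗ H → Avoids e (proj₂ e) (target e)
  head⇝target {e} e∈H with avoid-or-suffix e (π-reach e∈H)
  ... | inj₁ s⇝t = ⊥-elim (π-cut e∈H s⇝t)
  ... | inj₂ p   = p

  same-head-and-source⇒≡ : ∀ {e₁ e₂} → e₁ ∈ₗ H → e₂ ∈ₗ H →
                            proj₂ e₁ ≡ proj₂ e₂ → source e₁ ≡ source e₂ → e₁ ≡ e₂
  same-head-and-source⇒≡ {e₁} {e₂} _ _ _ _ with e₁ ≟ₑ e₂
  ... | yes e₁≡e₂ = e₁≡e₂
  same-head-and-source⇒≡ {u₁ , v} {u₂ , v} e₁∈ e₂∈ refl s₁≡s₂ | no e₁≢e₂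
    with first-arrival (forget-avoiding (source⇝tail e₁∈) ◅◅ e₁∈ ◅ ε)
  ... | inj₁ s₁≡v = ⊥-elim (cut e₁∈ (sym s₁≡v) (head⇝target e₁∈))
  ... | inj₂ (u , s⇝u , uv∈) with (u , v) ≟ₑ (u₁ , v)
  ...   | no  uv≢e₁ = ⊥-elim (π-cut e₁∈ (not-entering⇒avoiding s⇝u ◅◅ (uv∈ , uv≢e₁) ◅ head⇝target e₁∈))
  ...   | yes refl  = ⊥-elim (cut e₂∈ s₁≡s₂ (not-entering⇒avoiding s⇝u ◅◅ (uv∈ , e₁≢e₂) ◅ head⇝target e₂∈))

  OnCycle : Fin n × Fin n → Set
  OnCycle (u , v) = Reach H v u

  onCycle? : ∀ e → Dec (OnCycle e)
  onCycle? (u , v) = reach? _≟_ H v u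

  Sibling : Fin n × Fin n → Fin n × Fin n → Set
  Sibling e f = proj₂ f ≡ proj₂ e × f ≢ e

  sibling? : ∀ e f → Dec (Sibling e f)
  sibling? e f = (proj₂ f ≟ proj₂ e) ×-dec ¬? (f ≟ₑ e)

  -- Using f′ before e′ would close a cycle through e′.
  same-source⇒¬reach-sibling-tail : ∀ {e′ f f′} → e′ ∈ₗ H → f ∈ₗ H → f′ ∈ₗ H → ¬ OnCycle e′ →
                                     Sibling e′ f′ → source f ≡ source f′ → ¬ Reach H (proj₂ f) (proj₁ e′)
  same-source⇒¬reach-sibling-tail {c , v} {a , w} {b , v} e′∈ f∈ f′∈ acyclic (refl , f′≢e′) s≡s′ w⇝c =
    cut f′∈ s≡s′ (s⇝a ◅◅ (f∈ , f≢f′) ◅ w⇝c-avoiding ◅◅ (e′∈ , f′≢e′ ∘ sym) ◅ head⇝target f′∈)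
    where
    s⇝a : Avoids (b , v) (source (a , w)) a
    s⇝a with avoid-or-suffix (b , v) (forget-avoiding (source⇝tail f∈))
    ... | inj₁ p   = p
    ... | inj₂ v⇝a = ⊥-elim (acyclic (forget-avoiding v⇝a ◅◅ f∈ ◅ w⇝c))
    w⇝c-avoiding : Avoids (b , v) w c
    w⇝c-avoiding with avoid-or-suffix (b , v) w⇝c
    ... | inj₁ p   = p
    ... | inj₂ v⇝c = ⊥-elim (acyclic (forget-avoiding v⇝c))
    f≢f′ : (a , w) ≢ (b , v)
    f≢f′ refl = acyclic w⇝c

  shared-pair⇒ordered : ∀ {e e′} → e ∈ₗ H → e′ ∈ₗ H → e ≢ e′ → π e ≡ π e′ →
                        Reach H (proj₂ e) (proj₁ e′) ⊎ Reach H (proj₂ e′) (proj₁ e)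
  shared-pair⇒ordered {e} {e′} e∈ e′∈ e≢e′ πe≡πe′
    with avoid-or-suffix e′ (forget-avoiding (source⇝tail e∈))
  ... | inj₂ p = inj₂ (forget-avoiding p)
  ... | inj₁ s⇝tail with avoid-or-prefix e′ (forget-avoiding (head⇝target e∈))
  ...   | inj₂ (p , _) = inj₁ (forget-avoiding p)
  ...   | inj₁ head⇝t  =
    ⊥-elim (π-cut e′∈ (subst (uncurry (Avoids e′)) πe≡πe′ (s⇝tail ◅◅ (e∈ , e≢e′) ◅ head⇝t)))

  shared-pair⇒sibling-sources-differ : ∀ {e e′ f f′} → e ∈ₗ H → e′ ∈ₗ H → e ≢ e′ → π e ≡ π e′ →
    ¬ OnCycle e → ¬ OnCycle e′ → f ∈ₗ H → f′ ∈ₗ H → Sibling e f → Sibling e′ f′ → source f ≢ source f′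
  shared-pair⇒sibling-sources-differ {e} {e′} e∈ e′∈ e≢e′ πe≡πe′ acyclic acyclic′ f∈ f′∈ σ σ′ s≡s′
    with shared-pair⇒ordered e∈ e′∈ e≢e′ πe≡πe′
  ... | inj₁ p = same-source⇒¬reach-sibling-tail e′∈ f∈ f′∈ acyclic′ σ′ s≡s′
                   (subst (λ z → Reach H z (proj₁ e′)) (sym (proj₁ σ)) p)
  ... | inj₂ p = same-source⇒¬reach-sibling-tail e∈ f′∈ f∈ acyclic σ (sym s≡s′)
                   (subst (λ z → Reach H z (proj₁ e)) (sym (proj₁ σ′)) p)

  Mutual : Fin n → Fin n → Set
  Mutual x y = Reach H x y × Reach H y x

  mutual? : ∀ x y → Dec (Mutual x y)
  mutual? x y = reach? _≟_ H x y ×-dec reach? _≟_ H y x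

  rep : Fin n → Fin n
  rep v = first (λ w → mutual? w v) v (allFin n)

  rep-mutual : ∀ v → Mutual (rep v) v
  rep-mutual v = proj₂ (first-sound (λ w → mutual? w v) v (∈-allFin v) (ε , ε))

  rep-cong : ∀ {u v} → Mutual u v → rep u ≡ rep v
  rep-cong {u} {v} (u⇝v , v⇝u) =
    first-cong (λ w → mutual? w u) (λ w → mutual? w v)
               (λ (w⇝u , u⇝w) → w⇝u ◅◅ u⇝v , v⇝u ◅◅ u⇝w) (λ (w⇝v , v⇝w) → w⇝v ◅◅ v⇝u , u⇝v ◅◅ v⇝w)
               u v (∈-allFin u) (ε , ε)

  -- An edge u → v on a cycle that avoids both forests is bypassed by u ⇝ rep u = rep v ⇝ v.
  cycle-edges-in-forests : ∃[ F ] (length F ≤ n + n × ∀ {e} → e ∈ₗ H → OnCycle e → e ∈ₗ F)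
  cycle-edges-in-forests = Fo ++ map swap Fi , size , covered
    where
    out-forest = SpanningForest.spanning-forest H rep (proj₁ ∘ rep-mutual)
                   (λ {_} {v} ρv⇝x x⇝v → rep-cong (x⇝v , proj₂ (rep-mutual v) ◅◅ ρv⇝x))
    in-forest  = SpanningForest.spanning-forest (map swap H) rep (reach-swap ∘ proj₂ ∘ rep-mutual)
                   (λ {_} {v} ρv⇝x x⇝v →
                      rep-cong (reach-unswap ρv⇝x ◅◅ proj₁ (rep-mutual v) , reach-unswap x⇝v))
    Fo = proj₁ out-forest
    Fi = proj₁ in-forest
    F⊆H : Fo ++ map swap Fi ⊆ H
    F⊆H e∈ with ∈-++⁻ Fo e∈
    ... | inj₁ e∈Fo = proj₁ (proj₂ out-forest) e∈Fo
    ... | inj₂ e∈Fi = map-swap-⊆ (proj₁ (proj₂ in-forest)) e∈Fi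
    size : length (Fo ++ map swap Fi) ≤ n + n
    size = subst (_≤ n + n) (sym (trans (length-++ Fo) (cong (length Fo +_) (length-map swap Fi))))
                 (+-mono-≤ (proj₁ (proj₂ (proj₂ out-forest))) (proj₁ (proj₂ (proj₂ in-forest))))
    covered : ∀ {e} → e ∈ₗ H → OnCycle e → e ∈ₗ Fo ++ map swap Fi
    covered {e} _ _ with e ∈? (Fo ++ map swap Fi)
    ... | yes e∈F = e∈F
    covered {u , v} e∈H v⇝u | no e∉F = ⊥-elim (π-cut e∈H (bypass detour (π-reach e∈H)))
      where
      via-forests : ∀ {x y} → Reach (Fo ++ map swap Fi) x y → Avoids (u , v) x y
      via-forests = Star.map λ xy∈ → F⊆H xy∈ , λ { refl → e∉F xy∈ }
      detour : Avoids (u , v) u v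
      detour = via-forests (Star.map (∈-++⁺ʳ Fo) (reach-swap (proj₂ (proj₂ (proj₂ in-forest)) u)))
            ◅◅ subst (λ z → Avoids (u , v) z v) (sym (rep-cong (e∈H ◅ ε , v⇝u)))
                 (via-forests (Star.map ∈-++⁺ˡ (proj₂ (proj₂ (proj₂ out-forest)) v)))

  module Counting (H-unique : Unique H) (P : List (Fin n × Fin n)) (S : Subset n)
                  (π∈P : ∀ {e} → e ∈ₗ H → π e ∈ₗ P) (source∈S : ∀ {e} → e ∈ₗ H → source e ∈ S) where

    acyclic : List (Fin n × Fin n)
    acyclic = filter (∁? onCycle?) H

    ∈-acyclic⁻ : ∀ {e} → e ∈ₗ acyclic → e ∈ₗ H × ¬ OnCycle e
    ∈-acyclic⁻ = ∈-filter⁻ (∁? onCycle?) {xs = H}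

    acyclic-unique : Unique acyclic
    acyclic-unique = Unique.filter⁺ (∁? onCycle?) H-unique

    siblings : Fin n × Fin n → List (Fin n × Fin n)
    siblings e = filter (sibling? e) acyclic

    ∈-siblings⁻ : ∀ {e f} → f ∈ₗ siblings e → f ∈ₗ acyclic × Sibling e f
    ∈-siblings⁻ {e} = ∈-filter⁻ (sibling? e)

    length-cyclic : length (filter onCycle? H) ≤ n + n
    length-cyclic with F , |F|≤ , covered ← cycle-edges-in-forests =
      ≤-trans (length-≤-⊆ (Unique.filter⁺ onCycle? H-unique) (uncurry covered ∘ ∈-filter⁻ onCycle?)) |F|≤

    sibling-pairs-injective : ∀ {e e′ f f′} → e ∈ₗ acyclic → e′ ∈ₗ acyclic →
                              f ∈ₗ siblings e → f′ ∈ₗ siblings e′ →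
                              (π e , source f) ≡ (π e′ , source f′) → (e , f) ≡ (e′ , f′)
    sibling-pairs-injective {e} {e′} e∈ e′∈ f∈ f′∈ eq
      with e∈H , e-acyclic ← ∈-acyclic⁻ e∈ | e′∈H , e′-acyclic ← ∈-acyclic⁻ e′∈
         | f∈Ac , σ ← ∈-siblings⁻ f∈ | f′∈Ac , σ′ ← ∈-siblings⁻ f′∈
         | proj₂ e ≟ proj₂ e′
    ... | yes heads≡ = cong₂ _,_ e≡e′
      (same-head-and-source⇒≡ f∈H f′∈H (trans (proj₁ σ) (trans heads≡ (sym (proj₁ σ′)))) (cong proj₂ eq))
      where
      f∈H = proj₁ (∈-acyclic⁻ f∈Ac)
      f′∈H = proj₁ (∈-acyclic⁻ f′∈Ac)
      e≡e′ : e ≡ e′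
      e≡e′ = same-head-and-source⇒≡ e∈H e′∈H heads≡ (cong (proj₁ ∘ proj₁) eq)
    ... | no heads≢ = ⊥-elim
      (shared-pair⇒sibling-sources-differ e∈H e′∈H (heads≢ ∘ cong proj₂) (cong proj₁ eq) e-acyclic e′-acyclic
         (proj₁ (∈-acyclic⁻ f∈Ac)) (proj₁ (∈-acyclic⁻ f′∈Ac)) σ σ′ (cong proj₂ eq))

    module Threshold (d : ℕ) where

      High : Fin n × Fin n → Set
      High e = d ≤ length (siblings e)

      high? : ∀ e → Dec (High e)
      high? e = d ≤? length (siblings e)

      high low : List (Fin n × Fin n)
      high = filter high? acyclic
      low  = filter (∁? high?) acyclic

      ∈-high⁻ : ∀ {e} → e ∈ₗ high → e ∈ₗ acyclic × High e
      ∈-high⁻ = ∈-filter⁻ high? {xs = acyclic}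

      ∈-low⁻ : ∀ {e} → e ∈ₗ low → e ∈ₗ acyclic × ¬ High e
      ∈-low⁻ = ∈-filter⁻ (∁? high?) {xs = acyclic}

      sibling-pairs-into : ∀ {p} → p ∈ₗ pairs siblings high →
                           (π (proj₁ p) , source (proj₂ p)) ∈ₗ cartesianProduct P (elements S)
      sibling-pairs-into p∈ with e∈ , f∈ ← ∈-pairs⁻ siblings p∈ =
        ∈-cartesianProduct⁺ (π∈P (proj₁ (∈-acyclic⁻ (proj₁ (∈-high⁻ e∈)))))
                            (∈-elements (source∈S (proj₁ (∈-acyclic⁻ (proj₁ (∈-siblings⁻ f∈))))))

      length-high : length high * d ≤ length P * ∣ S ∣
      length-high = begin
        length high * d                          ≤⟨ length-pairs-≥ siblings high (proj₂ ∘ ∈-high⁻) ⟩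
        length (pairs siblings high)             ≤⟨ length-≤-injection (λ (e , f) → π e , source f)
                                                      (pairs-unique siblings (Unique.filter⁺ high? acyclic-unique)
                                                        (λ e → Unique.filter⁺ (sibling? e) acyclic-unique))
                                                      sibling-pairs-into injective ⟩
        length (cartesianProduct P (elements S)) ≡⟨ length-cartesianProduct P (elements S) ⟩
        length P * length (elements S)           ≡⟨ cong (length P *_) (length-elements S) ⟩
        length P * ∣ S ∣                         ∎
        where
        open ≤-Reasoning
        injective : ∀ {p q} → p ∈ₗ pairs siblings high → q ∈ₗ pairs siblings high →
                    (π (proj₁ p) , source (proj₂ p)) ≡ (π (proj₁ q) , source (proj₂ q)) → p ≡ q
        injective p∈ q∈ with e∈ , f∈ ← ∈-pairs⁻ siblings p∈ | e′∈ , f′∈ ← ∈-pairs⁻ siblings q∈ =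
          sibling-pairs-injective (proj₁ (∈-high⁻ e∈)) (proj₁ (∈-high⁻ e′∈)) f∈ f′∈

      in-degree-low : ∀ {e} → e ∈ₗ low → length (fibre _≟_ proj₂ (proj₂ e) acyclic) ≤ d
      in-degree-low {e} e∈ = ≤-trans (length-≤-⊆ (Unique.filter⁺ _ acyclic-unique) fibre⊆)
                                      (≰⇒> (proj₂ (∈-low⁻ e∈)))
        where
        fibre⊆ : fibre _≟_ proj₂ (proj₂ e) acyclic ⊆ e ∷ siblings e
        fibre⊆ {f} f∈ with f∈Ac , same-head ← ∈-filter⁻ (λ x → proj₂ x ≟ proj₂ e) {xs = acyclic} f∈
                     with f ≟ₑ e
        ... | yes f≡e = here f≡e
        ... | no  f≢e = there (∈-filter⁺ (sibling? e) f∈Ac (same-head , f≢e))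

      length-low : length low ≤ n * d
      length-low = subst (λ m → length low ≤ m * d) (length-tabulate {n = n} id)
        (length-≤-fibres _≟_ proj₂ (allFin n) (Unique.filter⁺ (∁? high?) acyclic-unique)
           (proj₁ ∘ ∈-low⁻) (λ {e} _ → ∈-allFin (proj₂ e)) in-degree-low)

    edge-count : ∀ d → ∃[ a ] (a * d ≤ length P * ∣ S ∣ × length H ≤ (n + n) + (a + n * d))
    edge-count d = length high , length-high , size
      where
      open Threshold d
      open ≤-Reasoning
      cyclic = filter onCycle? H
      size : length H ≤ (n + n) + (length high + n * d)
      size = begin
        length H                                   ≡⟨ length-filter-∁ onCycle? H ⟨
        length cyclic + length acyclic             ≡⟨ cong (length cyclic +_) (length-filter-∁ high? acyclic) ⟨
        length cyclic + (length high + length low) ≤⟨ +-mono-≤ length-cyclic (+-monoʳ-≤ (length high) length-low) ⟩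
        (n + n) + (length high + n * d)            ∎

module Preserver {n : ℕ} (G : Digraph n) (P : List (Fin n × Fin n)) where

  Preserves : List (Fin n × Fin n) → Set
  Preserves L = All (λ p → uncurry (Reachable G) p → uncurry (Reach L) p) P

  preserved? : ∀ L p → Dec (uncurry (Reachable G) p → uncurry (Reach L) p)
  preserved? L (s , t) = reach? _≟_ (edges G) s t →-dec reach? _≟_ L s t

  preserves? : Decidable Preserves
  preserves? L = All.all? (preserved? L) P

  preserves-mono : ∀ {L L′} → L ⊆ L′ → Preserves L → Preserves L′
  preserves-mono L⊆L′ = All.map (Star.map L⊆L′ ∘_)

  open MinimalSublist (_≟ₑ_ {n}) preserves? preserves-mono
  open Pruned (prune (edges G) (distinct G) (All.tabulate (λ _ → id)) (edges G)) public
    renaming (kept to H; kept⊆ to H⊆G; unique to H-unique; good to H-preserves)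

  Critical : Fin n × Fin n → Fin n × Fin n → Set
  Critical e p = uncurry (Reachable G) p × ¬ uncurry (Reach (remove e H)) p

  critical? : ∀ e p → Dec (Critical e p)
  critical? e (s , t) = reach? _≟_ (edges G) s t ×-dec ¬? (reach? _≟_ (remove e H) s t)

  π : Fin n × Fin n → Fin n × Fin n
  π e = first (critical? e) e P

  π-critical : ∀ {e} → e ∈ₗ H → π e ∈ₗ P × Critical e (π e)
  π-critical {e} e∈H
    with p , p∈P , ¬preserved ← find (¬All⇒Any¬ (preserved? (remove e H)) P (needed (H⊆G e∈H) e∈H)) =
    first-sound (critical? e) e p∈P (¬preserved⇒critical p ¬preserved)
    where
    ¬preserved⇒critical : ∀ p → ¬ (uncurry (Reachable G) p → uncurry (Reach (remove e H)) p) → Critical e p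
    ¬preserved⇒critical (s , t) ¬preserved with reach? _≟_ (edges G) s t
    ... | yes s⇝t = s⇝t , λ s⇝t′ → ¬preserved (λ _ → s⇝t′)
    ... | no ¬s⇝t = ⊥-elim (¬preserved (⊥-elim ∘ ¬s⇝t))

  π-reach : ∀ {e} → e ∈ₗ H → uncurry (Reach H) (π e)
  π-reach e∈H with π∈P , reachable , _ ← π-critical e∈H = All.lookup H-preserves π∈P reachable

  π-cut : ∀ {e} → e ∈ₗ H → ¬ uncurry (Star (Avoiding (EdgeIn H) e)) (π e)
  π-cut e∈H = proj₂ (proj₂ (π-critical e∈H)) ∘ Star.map (uncurry ∈-remove⁺)

sparse-preserver : ∀ {n} (G : Digraph n) (S : Subset n) (P : List (Fin n × Fin n)) →
  (∀ {s t} → (s , t) ∈ₗ P → s ∈ S) → ∀ d →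
  ∃[ H ] (H ⊆G G
         × (∃[ a ] (a * d ≤ length P * ∣ S ∣ × length (edges H) ≤ (n + n) + (a + n * d)))
         × (∀ {s t} → (s , t) ∈ₗ P → Reachable H s t ⇔ Reachable G s t))
sparse-preserver G S P sources∈S d =
  digraph H H-unique , H⊆G , edge-count d , λ st∈P → mk⇔ (Star.map H⊆G) (All.lookup H-preserves st∈P)
  where
  open Preserver G P
  open CriticalEdges H π π-reach π-cut
  open Counting H-unique P S (proj₁ ∘ π-critical) (sources∈S ∘ proj₁ ∘ π-critical)

isqrt : ∀ N → ∃[ r ] (r * r ≤ N × N < suc r * suc r)
isqrt zero = 0 , z≤n , s≤s z≤n
isqrt (suc N) with r , r²≤N , N<⟨1+r⟩² ← isqrt N with suc r * suc r ≤? suc N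
... | yes ⟨1+r⟩²≤1+N = suc r , ⟨1+r⟩²≤1+N , ≤-<-trans N<⟨1+r⟩² (*-mono-< (n<1+n (suc r)) (n<1+n (suc r)))
... | no  ⟨1+r⟩²≰1+N = r , m≤n⇒m≤1+n r²≤N , ≰⇒> ⟨1+r⟩²≰1+N

threshold : ∀ r n .{{_ : NonZero n}} → r < n * suc (r / n) × n * suc (r / n) ≤ r + n
threshold r n = r<n*q , n*q≤r+n
  where
  n*q≡n+n*[r/n] : n * suc (r / n) ≡ n + r / n * n
  n*q≡n+n*[r/n] = trans (*-suc n (r / n)) (cong (n +_) (*-comm n (r / n)))
  r<n*q : r < n * suc (r / n)
  r<n*q = begin-strict
    r                  ≡⟨ m≡m%n+[m/n]*n r n ⟩
    r % n + r / n * n  <⟨ +-monoˡ-< (r / n * n) (m%n<n r n) ⟩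
    n + r / n * n      ≡⟨ n*q≡n+n*[r/n] ⟨
    n * suc (r / n)    ∎
    where open ≤-Reasoning
  n*q≤r+n : n * suc (r / n) ≤ r + n
  n*q≤r+n = begin
    n * suc (r / n)    ≡⟨ n*q≡n+n*[r/n] ⟩
    n + r / n * n      ≤⟨ +-monoʳ-≤ n (m/n*n≤m r n) ⟩
    n + r              ≡⟨ +-comm n r ⟩
    r + n              ∎
    where open ≤-Reasoning

size-bound : ∀ {a d n p s r} → a * d ≤ p * s → n * p * s < suc r * suc r →
             r < n * d → n * d ≤ r + n → (n + n) + (a + n * d) ≤ 3 * (n + r)
size-bound {a} {d} {n} {p} {s} {r} ad≤ps nps<⟨1+r⟩² r<nd nd≤r+n = begin
  (n + n) + (a + n * d)       ≤⟨ +-monoʳ-≤ (n + n) (+-mono-≤ a≤r nd≤r+n) ⟩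
  (n + n) + (r + (r + n))     ≤⟨ m≤m+n _ r ⟩
  (n + n) + (r + (r + n)) + r ≡⟨ solve 2 (λ n r → (n :+ n) :+ (r :+ (r :+ n)) :+ r := con 3 :* (n :+ r))
                                        refl n r ⟩
  3 * (n + r)                 ∎
  where
  open ≤-Reasoning
  open +-*-Solver using (solve; _:+_; _:*_; _:=_; con)
  ⟨1+r⟩*a<⟨1+r⟩² : suc r * a < suc r * suc r
  ⟨1+r⟩*a<⟨1+r⟩² = begin-strict
    suc r * a          ≤⟨ *-monoˡ-≤ a r<nd ⟩
    n * d * a          ≡⟨ trans (*-assoc n d a) (cong (n *_) (*-comm d a)) ⟩
    n * (a * d)        ≤⟨ *-monoʳ-≤ n ad≤ps ⟩
    n * (p * s)        ≡⟨ *-assoc n p s ⟨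
    n * p * s          <⟨ nps<⟨1+r⟩² ⟩
    suc r * suc r      ∎
  a≤r : a ≤ r
  a≤r = m<1+n⇒m≤n (*-cancelˡ-< (suc r) a (suc r) ⟨1+r⟩*a<⟨1+r⟩²)

no-edges : (L : List (Fin 0 × Fin 0)) → length L ≤ 0
no-edges []             = z≤n
no-edges ((() , _) ∷ _)

theorem1 : ∃[ C ] ∀ (n : ℕ) (G : Digraph n) (S : Subset n)
               (P : List (Fin n × Fin n)) → Unique P
               → (∀ {s t} → (s , t) ∈ₗ P → s ∈ S)
               → ∃[ H ] (H ⊆G G)
                 × (∃[ r ] (r * r ≤ n * length P * ∣ S ∣)
                           × (length (edges H) ≤ C * (n + r)))
                 × (∀ {s t} → (s , t) ∈ₗ P → Reachable H s t ⇔ Reachable G s t)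
theorem1 = 3 , λ where
  zero      G _ _ _ _ → G , id , (0 , z≤n , no-edges (edges G)) , λ _ → mk⇔ id id
  -- Repetitions in P only enlarge the bound.
  n@(suc _) G S P _ sources∈S →
    let r , r²≤N , N<⟨1+r⟩²                 = isqrt (n * length P * ∣ S ∣)
        r<nd , nd≤r+n                       = threshold r n
        H , H⊆G , (a , ad≤ , |H|≤) , reach⇔ = sparse-preserver G S P sources∈S (suc (r / n))
        |H|≤3⟨n+r⟩ = ≤-trans |H|≤ (size-bound {p = length P} {s = ∣ S ∣} ad≤ N<⟨1+r⟩² r<nd nd≤r+n)
    in H , H⊆G , (r , r²≤N , |H|≤3⟨n+r⟩) , reach⇔
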